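{- Let $r$ be a positive integer and let $G$ be a graph of maximum degree at most $\Delta$. Then $$\chi_r'(G)\leq \frac{2(\Delta-1)^2}{r+1}+2(\Delta-1)+1.$$
   Context: All graphs are finite, simple and undirected. For a non-negative integer $r$, a graph is $r$-degenerate if every subgraph of order at least one has a vertex of degree at most $r$. For a matching $M$ in $G$, let $V(M)$ be the set of vertices incident with an edge of $M$. A matching $M$ is $r$-degenerate if the induced subgraph $G[V(M)]$ is $r$-degenerate. An $r$-degenerate edge coloring of $G$ is a partition of $E(G)$ into $r$-degenerate matchings, and $\chi_r'(G)$ (the $r$-degenerate chromatic index) is the minimum number of classes in such a partition. -}

module Defs where

open import Data.Nat using (ℕ; zero; suc; _+_; _*_; _∸_; _^_; _≤_)
open import Data.Fin using (Fin; zero; suc)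
open import Data.Bool using (Bool; true; false; T; _∧_)
open import Data.Product using (Σ; ∃; _×_; _,_)
import Data.Empty
open import Relation.Binary.PropositionalEquality using (_≡_; _≢_)

count : ∀ {n} → (Fin n → Bool) → ℕ
count {zero} f = 0
count {suc n} f with f zero
... | true  = suc (count (λ i → f (suc i)))
... | false = count (λ i → f (suc i))

record Graph : Set where
  field
    n     : ℕ
    adj   : Fin n → Fin n → Bool
    sym   : ∀ u v → T (adj u v) → T (adj v u)
    irrfl : ∀ u → T (adj u u) → Data.Empty.⊥
open Graph public

deg : ∀ {n} → (Fin n → Fin n → Bool) → Fin n → ℕ
deg F u = count (F u)

MaxDegAtMost : Graph → ℕ → Set
MaxDegAtMost G Δ = ∀ u → deg (adj G) u ≤ Δ

IsSubgraphOfInduced : (G : Graph) → (Fin (n G) → Set)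
                    → (Fin (n G) → Bool) → (Fin (n G) → Fin (n G) → Bool) → Set
IsSubgraphOfInduced G P S F =
  (∀ u → T (S u) → P u) ×
  (∀ u v → T (F u v) → T (adj G u v) × T (S u) × T (S v)) ×
  (∀ u v → T (F u v) → T (F v u))

DegenerateInduced : (G : Graph) → (Fin (n G) → Set) → ℕ → Set
DegenerateInduced G P r =
  ∀ (S : Fin (n G) → Bool) (F : Fin (n G) → Fin (n G) → Bool) →
  IsSubgraphOfInduced G P S F →
  (∃ λ u → T (S u)) →
  ∃ λ u → T (S u) × deg F u ≤ r

-- An edge colouring with k colours: a colour c u v for each edge uv,
-- given symmetrically (values on non-edges are irrelevant).
IsMatchingColouring : (G : Graph) (k : ℕ) → (Fin (n G) → Fin (n G) → Fin k) → Set
IsMatchingColouring G k c =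
  (∀ u v → T (adj G u v) → c u v ≡ c v u) ×
  (∀ u v w → T (adj G u v) → T (adj G u w) → v ≢ w → c u v ≢ c u w)

VM : (G : Graph) {k : ℕ} → (Fin (n G) → Fin (n G) → Fin k) → Fin k → Fin (n G) → Set
VM G c i x = ∃ λ y → T (adj G x y) × c x y ≡ i

-- An r-degenerate edge colouring with k colours (partition of E(G) into
-- k r-degenerate matchings; empty classes allowed, which is harmless for χ'_r ≤ bound).
IsDegEdgeColouring : (G : Graph) (r k : ℕ) → (Fin (n G) → Fin (n G) → Fin k) → Set
IsDegEdgeColouring G r k c =
  IsMatchingColouring G k c × (∀ i → DegenerateInduced G (VM G c i) r)

-- χ'_r(G) ≤ a / b  (rational bound, b > 0), i.e. some admissible k has b * k ≤ a.
ChiDegAtMostFrac : Graph → ℕ → ℕ → ℕ → Set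
ChiDegAtMostFrac G r a b = Σ ℕ λ k → b * k ≤ a × Σ (Fin (n G) → Fin (n G) → Fin k) (IsDegEdgeColouring G r k)

-- Proof: a greedy colouring with K = 2D + ⌊2D²/(r+1)⌋ + 1 colours, where D = Δ - 1, that
-- keeps every colour class an r-degenerate matching while edges are added one at a time.
-- Then class j stays r-degenerate (extension lemma): a subgraph of G[V(M_j)] avoiding u and
-- v lies in the old class, one containing u but not v has deg u ≤ r, and one containing both
-- has the endpoint with fewer such neighbours of degree ≤ r.  Since each class is a
-- matching, (b) is read off the list of ≤ 2D² colours on edges leaving the neighbourhoods of
-- u and v, and at most 2D colours violate (a); a weighted pigeonhole principle then yields j
-- as soon as (r+1)·2D + 2D² < (r+1)·K.
module Submission where

open import Defs
open import Data.Nat using (ℕ; zero; suc; _+_; _*_; _∸_; _^_; _≤_; _<_; z≤n; s≤s; _≤?_; _≟_)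
open import Data.Nat.Properties
open import Data.Fin using (Fin; zero; suc; toℕ; fromℕ<)
import Data.Fin as Fin
import Data.Fin.Properties as FinP
open import Data.Bool using (Bool; true; false; T)
open import Data.Product using (Σ; ∃; _×_; _,_; proj₁; proj₂)
open import Data.Sum using (_⊎_; inj₁; inj₂; reduce)
open import Data.Empty using (⊥; ⊥-elim)
open import Data.Unit using (tt)
open import Data.List using (List; []; _∷_; _++_; length; concat)
open import Data.List.Properties using (length-++)
open import Function using (_∘_)
open import Relation.Nullary using (¬_; Dec; yes; no)
open import Relation.Nullary.Decidable using (⌊_⌋; toWitness; T?; _×-dec_; _⊎-dec_)
open import Data.Nat.DivMod using (_/_; _%_; m/n*n≤m; m≡m%n+[m/n]*n; m%n<n)
open import Data.Nat.Tactic.RingSolver using (solve-∀)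
open import Relation.Binary.PropositionalEquality
  using (_≡_; _≢_; refl; cong; trans; subst) renaming (sym to ≡-sym)

count-mono : ∀ {n} (f g : Fin n → Bool) → (∀ i → T (f i) → T (g i)) → count f ≤ count g
count-mono {zero}  f g f⊆g = z≤n
count-mono {suc n} f g f⊆g with f zero | g zero | f⊆g zero
... | true  | true  | _  = s≤s (count-mono (f ∘ suc) (g ∘ suc) (f⊆g ∘ suc))
... | true  | false | h₀ = ⊥-elim (h₀ tt)
... | false | true  | _  = m≤n⇒m≤1+n (count-mono (f ∘ suc) (g ∘ suc) (f⊆g ∘ suc))
... | false | false | _  = count-mono (f ∘ suc) (g ∘ suc) (f⊆g ∘ suc)

count-strict : ∀ {n} (f g : Fin n → Bool) (k : Fin n) → (∀ i → T (f i) → T (g i)) →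
               T (g k) → ¬ T (f k) → suc (count f) ≤ count g
count-strict {suc n} f g zero f⊆g gk ¬fk with f zero | g zero
... | true  | _     = ⊥-elim (¬fk tt)
... | false | true  = s≤s (count-mono (f ∘ suc) (g ∘ suc) (f⊆g ∘ suc))
... | false | false = ⊥-elim gk
count-strict {suc n} f g (suc k) f⊆g gk ¬fk with f zero | g zero | f⊆g zero
... | true  | true  | _  = s≤s (count-strict (f ∘ suc) (g ∘ suc) k (f⊆g ∘ suc) gk ¬fk)
... | true  | false | h₀ = ⊥-elim (h₀ tt)
... | false | true  | _  = m≤n⇒m≤1+n (count-strict (f ∘ suc) (g ∘ suc) k (f⊆g ∘ suc) gk ¬fk)
... | false | false | _  = count-strict (f ∘ suc) (g ∘ suc) k (f⊆g ∘ suc) gk ¬fk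

count-split : ∀ {n} (f g h : Fin n → Bool) → (∀ i → T (f i) → T (g i) ⊎ T (h i)) →
              count f ≤ count g + count h
count-split {zero}  f g h cover = z≤n
count-split {suc n} f g h cover
  with count-split (f ∘ suc) (g ∘ suc) (h ∘ suc) (cover ∘ suc) | f zero | g zero | h zero | cover zero
... | rest | true  | true  | true  | _  = s≤s (≤-trans rest (+-monoʳ-≤ _ (n≤1+n _)))
... | rest | true  | true  | false | _  = s≤s rest
... | rest | true  | false | true  | _  = ≤-trans (s≤s rest) (≤-reflexive (≡-sym (+-suc _ _)))
... | rest | true  | false | false | c₀ = ⊥-elim (reduce (c₀ tt))
... | rest | false | true  | true  | _  = m≤n⇒m≤1+n (≤-trans rest (+-monoʳ-≤ _ (n≤1+n _)))
... | rest | false | true  | false | _  = m≤n⇒m≤1+n rest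
... | rest | false | false | true  | _  = ≤-trans rest (+-monoʳ-≤ _ (n≤1+n _))
... | rest | false | false | false | _  = rest

count-none : ∀ {n} (f : Fin n → Bool) → (∀ i → ¬ T (f i)) → count f ≡ 0
count-none {zero}  f none = refl
count-none {suc n} f none with f zero | none zero
... | true  | n₀ = ⊥-elim (n₀ tt)
... | false | _  = count-none (f ∘ suc) (none ∘ suc)

count-at-most-one : ∀ {n} (f : Fin n → Bool) → (∀ i j → T (f i) → T (f j) → i ≡ j) →
                    count f ≤ 1
count-at-most-one {zero}  f unique = z≤n
count-at-most-one {suc n} f unique with f zero | unique zero
... | true  | u₀ =
  s≤s (≤-reflexive (count-none (f ∘ suc) (λ i fi → FinP.0≢1+n (u₀ (suc i) tt fi))))
... | false | _  = count-at-most-one (f ∘ suc)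
                     (λ i j fi fj → FinP.suc-injective (unique (suc i) (suc j) fi fj))

sumF : ∀ {n} → (Fin n → ℕ) → ℕ
sumF {zero}  f = 0
sumF {suc n} f = f zero + sumF (f ∘ suc)

sumF-mono : ∀ {n} (f g : Fin n → ℕ) → (∀ i → f i ≤ g i) → sumF f ≤ sumF g
sumF-mono {zero}  f g f≤g = z≤n
sumF-mono {suc n} f g f≤g = +-mono-≤ (f≤g zero) (sumF-mono (f ∘ suc) (g ∘ suc) (f≤g ∘ suc))

sumF-strict : ∀ {n} (f g : Fin n → ℕ) (k : Fin n) → (∀ i → f i ≤ g i) → f k < g k →
              sumF f < sumF g
sumF-strict {suc n} f g zero    f≤g fk<gk =
  +-mono-<-≤ fk<gk (sumF-mono (f ∘ suc) (g ∘ suc) (f≤g ∘ suc))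
sumF-strict {suc n} f g (suc k) f≤g fk<gk =
  +-mono-≤-< (f≤g zero) (sumF-strict (f ∘ suc) (g ∘ suc) k (f≤g ∘ suc) fk<gk)

_except_ : ∀ {n} → (Fin n → Bool) → Fin n → Fin n → Bool
(f except y) w with w Fin.≟ y
... | yes _ = false
... | no  _ = f w

except-intro : ∀ {n} (f : Fin n → Bool) {y w} → T (f w) → w ≢ y → T ((f except y) w)
except-intro f {y} {w} fw w≢y with w Fin.≟ y
... | yes w≡y = w≢y w≡y
... | no  _   = fw

except-elim : ∀ {n} (f : Fin n → Bool) {y w} → T ((f except y) w) → T (f w) × w ≢ y
except-elim f {y} {w} t with w Fin.≟ y
... | yes _   = ⊥-elim t
... | no  w≢y = t , w≢y

except-removes : ∀ {n} (f : Fin n → Bool) (y : Fin n) → ¬ T ((f except y) y)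
except-removes f y t = proj₂ (except-elim f {y} t) refl

count-except : ∀ {n} (f : Fin n → Bool) (y : Fin n) → count f ≤ suc (count (f except y))
count-except {n} f y =
  ≤-trans (count-split f (f except y) isY cover)
          (≤-trans (+-monoʳ-≤ _ (count-at-most-one isY single)) (≤-reflexive (+-comm _ 1)))
  where
  isY : Fin n → Bool
  isY w = ⌊ w Fin.≟ y ⌋
  single : ∀ i j → T (isY i) → T (isY j) → i ≡ j
  single i j i≡y j≡y = trans (toWitness i≡y) (≡-sym (toWitness j≡y))
  cover : ∀ w → T (f w) → T ((f except y) w) ⊎ T (isY w)
  cover w fw with w Fin.≟ y
  ... | yes _ = inj₂ tt
  ... | no  _ = inj₁ fw

collect : ∀ {n} {A : Set} → (Fin n → Bool) → (Fin n → A) → List A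
collect {zero}  f g = []
collect {suc n} f g with f zero
... | true  = g zero ∷ collect (f ∘ suc) (g ∘ suc)
... | false = collect (f ∘ suc) (g ∘ suc)

length-collect : ∀ {n} {A : Set} (f : Fin n → Bool) (g : Fin n → A) →
                 length (collect f g) ≡ count f
length-collect {zero}  f g = refl
length-collect {suc n} f g with f zero
... | true  = cong suc (length-collect (f ∘ suc) (g ∘ suc))
... | false = length-collect (f ∘ suc) (g ∘ suc)

occ : ∀ {K} → Fin K → List (Fin K) → ℕ
occ j []       = 0
occ j (x ∷ xs) with x Fin.≟ j
... | yes _ = suc (occ j xs)
... | no  _ = occ j xs

occ-++ : ∀ {K} (j : Fin K) xs ys → occ j (xs ++ ys) ≡ occ j xs + occ j ys
occ-++ j []       ys = refl
occ-++ j (x ∷ xs) ys with x Fin.≟ j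
... | yes _ = cong suc (occ-++ j xs ys)
... | no  _ = occ-++ j xs ys

occ-collect : ∀ {n K} (f : Fin n → Bool) (g : Fin n → Fin K) (j : Fin K) (i : Fin n) →
              T (f i) → g i ≡ j → 1 ≤ occ j (collect f g)
occ-collect {suc n} f g j i fi gi≡j with f zero in f₀
occ-collect {suc n} f g j i fi gi≡j | true with g zero Fin.≟ j
... | yes _ = s≤s z≤n
occ-collect {suc n} f g j zero    fi gi≡j | true | no g₀≢j = ⊥-elim (g₀≢j gi≡j)
occ-collect {suc n} f g j (suc i) fi gi≡j | true | no _    =
  occ-collect (f ∘ suc) (g ∘ suc) j i fi gi≡j
occ-collect {suc n} f g j zero    fi gi≡j | false = ⊥-elim (subst T f₀ fi)
occ-collect {suc n} f g j (suc i) fi gi≡j | false = occ-collect (f ∘ suc) (g ∘ suc) j i fi gi≡j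

collect-avoids : ∀ {n K} (f : Fin n → Bool) (g : Fin n → Fin K) (j : Fin K) →
                 occ j (collect f g) ≡ 0 → ∀ i → T (f i) → g i ≢ j
collect-avoids f g j absent i fi gi≡j = n≮0 (subst (1 ≤_) absent (occ-collect f g j i fi gi≡j))

length-concat-collect : ∀ {n K} (a : Fin n → Bool) (h : Fin n → List (Fin K)) (B : ℕ) →
  (∀ w → T (a w) → length (h w) ≤ B) → length (concat (collect a h)) ≤ count a * B
length-concat-collect {zero}  a h B short = z≤n
length-concat-collect {suc n} a h B short with a zero | short zero
... | true  | short₀ =
  ≤-trans (≤-reflexive (length-++ (h zero)))
          (+-mono-≤ (short₀ tt) (length-concat-collect (a ∘ suc) (h ∘ suc) B (short ∘ suc)))
... | false | _      = length-concat-collect (a ∘ suc) (h ∘ suc) B (short ∘ suc)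

count-≤-occ-concat : ∀ {n K} (j : Fin K) (f a : Fin n → Bool) (h : Fin n → List (Fin K)) →
  (∀ w → T (f w) → T (a w) × 1 ≤ occ j (h w)) → count f ≤ occ j (concat (collect a h))
count-≤-occ-concat {zero}  j f a h hits = z≤n
count-≤-occ-concat {suc n} j f a h hits
  with count-≤-occ-concat j (f ∘ suc) (a ∘ suc) (h ∘ suc) (hits ∘ suc) | f zero | a zero | hits zero
... | rest | true  | true  | hit₀ =
  ≤-trans (+-mono-≤ (proj₂ (hit₀ tt)) rest) (≤-reflexive (≡-sym (occ-++ j (h zero) _)))
... | rest | true  | false | hit₀ = ⊥-elim (proj₁ (hit₀ tt))
... | rest | false | true  | _    =
  ≤-trans (≤-trans rest (m≤n+m _ (occ j (h zero)))) (≤-reflexive (≡-sym (occ-++ j (h zero) _)))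
... | rest | false | false | _    = rest

removeAll : ∀ {K} → Fin K → List (Fin K) → List (Fin K)
removeAll j []       = []
removeAll j (x ∷ xs) with x Fin.≟ j
... | yes _ = removeAll j xs
... | no  _ = x ∷ removeAll j xs

length-removeAll : ∀ {K} (j : Fin K) xs → length xs ≡ occ j xs + length (removeAll j xs)
length-removeAll j []       = refl
length-removeAll j (x ∷ xs) with x Fin.≟ j
... | yes _ = cong suc (length-removeAll j xs)
... | no  _ = trans (cong suc (length-removeAll j xs)) (≡-sym (+-suc _ _))

occ-removeAll : ∀ {K} (i j : Fin K) xs → i ≢ j → occ i (removeAll j xs) ≡ occ i xs
occ-removeAll i j []       i≢j = refl
occ-removeAll i j (x ∷ xs) i≢j with x Fin.≟ j
... | no _ with x Fin.≟ i
...   | yes _ = cong suc (occ-removeAll i j xs i≢j)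
...   | no  _ = occ-removeAll i j xs i≢j
occ-removeAll i j (x ∷ xs) i≢j | yes refl with x Fin.≟ i
...   | yes refl = ⊥-elim (i≢j refl)
...   | no  _    = occ-removeAll i x xs i≢j

drop-share : ∀ R X Y m → X + R ≤ Y → Y < R * suc m → X < R * m
drop-share R X Y m X+R≤Y Y<R[1+m] =
  +-cancelˡ-< R X (R * m) (begin-strict
    R + X    ≡⟨ +-comm R X ⟩
    X + R    ≤⟨ X+R≤Y ⟩
    Y        <⟨ Y<R[1+m] ⟩
    R * suc m ≡⟨ *-suc R m ⟩
    R + R * m ∎)
  where open ≤-Reasoning

index-≢ : ∀ {K m} (i j : Fin K) → toℕ j ≡ m → toℕ i < m → i ≢ j
index-≢ i j toℕj≡m i<m refl = <-irrefl toℕj≡m i<m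

suc-smaller-≤ : ∀ a b s → 1 ≤ s → a ≤ b → a + b ≤ s → suc a ≤ s
suc-smaller-≤ zero    b s 1≤s a≤b a+b≤s = 1≤s
suc-smaller-≤ (suc a) b s 1≤s a≤b a+b≤s =
  ≤-trans (≤-trans (≤-reflexive (+-comm 1 (suc a))) (+-monoʳ-≤ (suc a) (≤-trans (s≤s z≤n) a≤b)))
          a+b≤s

-- Give each colour j the weight (r+1)·occ j A + occ j B.  Induction on m: if colour m-1 fails, deleting
-- its occurrences from A or from B lowers the total by at least r+1.
pigeonhole-below : (r : ℕ) {K : ℕ} (m : ℕ) → m ≤ K → (A B : List (Fin K)) →
  suc r * length A + length B < suc r * m →
  ∃ λ j → toℕ j < m × occ j A ≡ 0 × occ j B ≤ r
pigeonhole-below r zero m≤K A B small =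
  ⊥-elim (n≮0 (subst (suc r * length A + length B <_) (*-zeroʳ (suc r)) small))
pigeonhole-below r {K} (suc m) m<K A B small
  with fromℕ< m<K | FinP.toℕ-fromℕ< m<K | occ (fromℕ< m<K) A ≟ 0 | occ (fromℕ< m<K) B ≤? r
... | j | toℕj≡m | yes absent | yes rare = j , ≤-reflexive (cong suc toℕj≡m) , absent , rare
... | j | toℕj≡m | no present | _
  with pigeonhole-below r m (<⇒≤ m<K) (removeAll j A) B (drop-share (suc r) _ _ m shrink small)
  where
  open ≤-Reasoning
  share : suc r ≤ suc r * occ j A
  share = ≤-trans (≤-reflexive (≡-sym (*-identityʳ (suc r)))) (*-monoʳ-≤ (suc r) (n≢0⇒n>0 present))
  shrink : suc r * length (removeAll j A) + length B + suc r ≤ suc r * length A + length B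
  shrink = begin
    suc r * length (removeAll j A) + length B + suc r
      ≡⟨ +-comm (suc r * length (removeAll j A) + length B) (suc r) ⟩
    suc r + (suc r * length (removeAll j A) + length B)
      ≡⟨ ≡-sym (+-assoc (suc r) _ _) ⟩
    suc r + suc r * length (removeAll j A) + length B
      ≤⟨ +-monoˡ-≤ (length B) (+-monoˡ-≤ _ share) ⟩
    suc r * occ j A + suc r * length (removeAll j A) + length B
      ≡⟨ cong (_+ length B) (≡-sym (*-distribˡ-+ (suc r) (occ j A) _)) ⟩
    suc r * (occ j A + length (removeAll j A)) + length B
      ≡⟨ cong (λ t → suc r * t + length B) (≡-sym (length-removeAll j A)) ⟩
    suc r * length A + length B ∎
... | j' , j'<m , absent , rare =
  j' , <-trans j'<m (n<1+n m) ,
  trans (≡-sym (occ-removeAll j' j A (index-≢ j' j toℕj≡m j'<m))) absent , rare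
pigeonhole-below r {K} (suc m) m<K A B small | j | toℕj≡m | yes absent | no frequent
  with pigeonhole-below r m (<⇒≤ m<K) A (removeAll j B) (drop-share (suc r) _ _ m shrink small)
  where
  open ≤-Reasoning
  shrink : suc r * length A + length (removeAll j B) + suc r ≤ suc r * length A + length B
  shrink = begin
    suc r * length A + length (removeAll j B) + suc r
      ≡⟨ +-assoc (suc r * length A) _ (suc r) ⟩
    suc r * length A + (length (removeAll j B) + suc r)
      ≤⟨ +-monoʳ-≤ (suc r * length A) (+-monoʳ-≤ _ (≰⇒> frequent)) ⟩
    suc r * length A + (length (removeAll j B) + occ j B)
      ≡⟨ cong (suc r * length A +_) (trans (+-comm _ (occ j B)) (≡-sym (length-removeAll j B))) ⟩
    suc r * length A + length B ∎
... | j' , j'<m , absent' , rare =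
  j' , <-trans j'<m (n<1+n m) , absent' ,
  subst (_≤ r) (occ-removeAll j' j B (index-≢ j' j toℕj≡m j'<m)) rare

pigeonhole : (r : ℕ) {K : ℕ} (A B : List (Fin K)) → suc r * length A + length B < suc r * K →
             ∃ λ j → occ j A ≡ 0 × occ j B ≤ r
pigeonhole r {K} A B small with pigeonhole-below r K ≤-refl A B small
... | j , _ , absent , rare = j , absent , rare

-- Partial colourings of G with palette Fin K.  The colouring is built one edge at a time, so
-- we work with symmetric edge sets E ⊆ E(G) and colourings c of them, given on ordered pairs.
module PartialColourings (G : Graph) (r K : ℕ) where

  V : Set
  V = Fin (n G)

  EdgeSet : Set
  EdgeSet = V → V → Bool

  Colouring : Set
  Colouring = V → V → Fin K

  InG : EdgeSet → Set
  InG E = ∀ x y → T (E x y) → T (adj G x y)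

  Symmetric : EdgeSet → Set
  Symmetric E = ∀ x y → T (E x y) → T (E y x)

  ClassVertices : EdgeSet → Colouring → Fin K → V → Set
  ClassVertices E c i x = ∃ λ y → T (E x y) × c x y ≡ i

  -- c is an r-degenerate edge colouring of the spanning subgraph (V(G), E); for E = E(G)
  -- this is literally `IsDegEdgeColouring G r K c`.
  IsGood : EdgeSet → Colouring → Set
  IsGood E c = ((∀ x y → T (E x y) → c x y ≡ c y x) ×
                (∀ x y w → T (E x y) → T (E x w) → y ≢ w → c x y ≢ c x w)) ×
               (∀ i → DegenerateInduced G (ClassVertices E c i) r)

  edgeless-good : (E : EdgeSet) → (∀ x y → ¬ T (E x y)) → (c : Colouring) → IsGood E c
  edgeless-good E none c =
    ((λ x y e → ⊥-elim (none x y e)) , (λ x y w e → ⊥-elim (none x y e))) ,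
    (λ { i S F (S⊆class , _) (x , Sx) → ⊥-elim (none x _ (proj₁ (proj₂ (S⊆class x Sx)))) })

  IsEdge : V → V → V → V → Set
  IsEdge u v x y = (x ≡ u × y ≡ v) ⊎ (x ≡ v × y ≡ u)

  isEdge? : ∀ u v x y → Dec (IsEdge u v x y)
  isEdge? u v x y = ((x Fin.≟ u) ×-dec (y Fin.≟ v)) ⊎-dec ((x Fin.≟ v) ×-dec (y Fin.≟ u))

  isEdge-swap : ∀ {u v x y} → IsEdge u v x y → IsEdge u v y x
  isEdge-swap (inj₁ (x≡u , y≡v)) = inj₂ (y≡v , x≡u)
  isEdge-swap (inj₂ (x≡v , y≡u)) = inj₁ (y≡u , x≡v)

  isEdge-end : ∀ {u v x y} → IsEdge u v x y → x ≡ u ⊎ x ≡ v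
  isEdge-end (inj₁ (x≡u , _)) = inj₁ x≡u
  isEdge-end (inj₂ (x≡v , _)) = inj₂ x≡v

  deleteEdge : V → V → EdgeSet → EdgeSet
  deleteEdge u v E x y with isEdge? u v x y
  ... | yes _ = false
  ... | no  _ = E x y

  deleteEdge-⊆ : ∀ u v E x y → T (deleteEdge u v E x y) → T (E x y)
  deleteEdge-⊆ u v E x y e with isEdge? u v x y
  ... | yes _ = ⊥-elim e
  ... | no  _ = e

  deleteEdge-sym : ∀ u v E → Symmetric E → Symmetric (deleteEdge u v E)
  deleteEdge-sym u v E E-sym x y e with isEdge? u v x y | isEdge? u v y x
  ... | yes _    | _        = ⊥-elim e
  ... | no  ¬xy  | yes yx   = ¬xy (isEdge-swap yx)
  ... | no  _    | no  _    = E-sym x y e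

  deleteEdge-restores : ∀ u v E x y → T (E x y) → T (deleteEdge u v E x y) ⊎ IsEdge u v x y
  deleteEdge-restores u v E x y e with isEdge? u v x y
  ... | yes xy = inj₂ xy
  ... | no  _  = inj₁ e

  deleteEdge-deletes : ∀ u v E → ¬ T (deleteEdge u v E u v)
  deleteEdge-deletes u v E e with isEdge? u v u v
  ... | yes _   = e
  ... | no  ¬uv = ¬uv (inj₁ (refl , refl))

  deleteEdge-in-G : ∀ u v E → InG E → InG (deleteEdge u v E)
  deleteEdge-in-G u v E E-in-G x y e = E-in-G x y (deleteEdge-⊆ u v E x y e)

  size : EdgeSet → ℕ
  size E = sumF (λ x → count (E x))

  deleteEdge-smaller : ∀ u v E → T (E u v) → size (deleteEdge u v E) < size E
  deleteEdge-smaller u v E e =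
    sumF-strict (λ x → count (deleteEdge u v E x)) (λ x → count (E x)) u
      (λ x → count-mono _ _ (deleteEdge-⊆ u v E x))
      (count-strict (deleteEdge u v E u) (E u) v (deleteEdge-⊆ u v E u) e (deleteEdge-deletes u v E))

  coloursAt : EdgeSet → Colouring → V → List (Fin K)
  coloursAt E c X = collect (E X) (c X)

  -- Colours of the E-edges wy with w a G-neighbour of X other than Y and y ≠ X.  Since each
  -- class is a matching, j occurs here once for every such w lying in V(M_j).
  coloursNear : EdgeSet → Colouring → V → V → List (Fin K)
  coloursNear E c X Y = concat (collect (adj G X except Y) (λ w → collect (E w except X) (c w)))

  -- The result c is good: class j stays a matching; a subgraph of G[V(M_j)] avoiding
  -- u and v lies in the old class j, and one containing u or v has u or v of degree ≤ r.
  module Extension (r≥1 : 1 ≤ r) (E E' : EdgeSet) (u v : V)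
    (E'-in-G : InG E') (E'-sym : Symmetric E')
    (E⊆E'+uv : ∀ x y → T (E x y) → T (E' x y) ⊎ IsEdge u v x y) (uv-in-G : T (adj G u v))
    (c' : Colouring) (c'-good : IsGood E' c') (j : Fin K)
    (j∉u : ∀ w → T (E' u w) → c' u w ≢ j) (j∉v : ∀ w → T (E' v w) → c' v w ≢ j)
    (j-rare : occ j (coloursNear E' c' u v) + occ j (coloursNear E' c' v u) ≤ r) where

    c : Colouring
    c x y with isEdge? u v x y
    ... | yes _ = j
    ... | no  _ = c' x y

    c'-sym : ∀ x y → T (E' x y) → c' x y ≡ c' y x
    c'-sym = proj₁ (proj₁ c'-good)

    c'-matching : ∀ x y w → T (E' x y) → T (E' x w) → y ≢ w → c' x y ≢ c' x w
    c'-matching = proj₂ (proj₁ c'-good)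

    c'-degenerate : ∀ i → DegenerateInduced G (ClassVertices E' c' i) r
    c'-degenerate = proj₂ c'-good

    u≢v : u ≢ v
    u≢v refl = irrfl G u uv-in-G

    old-edge : ∀ x y → T (E x y) → ¬ IsEdge u v x y → T (E' x y)
    old-edge x y e ¬xy with E⊆E'+uv x y e
    ... | inj₁ e' = e'
    ... | inj₂ xy = ⊥-elim (¬xy xy)

    c-sym : ∀ x y → T (E x y) → c x y ≡ c y x
    c-sym x y e with isEdge? u v x y | isEdge? u v y x
    ... | yes _   | yes _   = refl
    ... | yes xy  | no  ¬yx = ⊥-elim (¬yx (isEdge-swap xy))
    ... | no  ¬xy | yes yx  = ⊥-elim (¬xy (isEdge-swap yx))
    ... | no  ¬xy | no  _   = c'-sym x y (old-edge x y e ¬xy)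

    j-free : ∀ x w → (x ≡ u ⊎ x ≡ v) → T (E' x w) → j ≢ c' x w
    j-free x w (inj₁ refl) e j≡c = j∉u w e (≡-sym j≡c)
    j-free x w (inj₂ refl) e j≡c = j∉v w e (≡-sym j≡c)

    c-matching : ∀ x y w → T (E x y) → T (E x w) → y ≢ w → c x y ≢ c x w
    c-matching x y w exy exw y≢w with isEdge? u v x y | isEdge? u v x w
    ... | yes (inj₁ (refl , refl)) | yes (inj₁ (_ , refl)) = λ _ → y≢w refl
    ... | yes (inj₂ (refl , refl)) | yes (inj₂ (_ , refl)) = λ _ → y≢w refl
    ... | yes (inj₁ (refl , refl)) | yes (inj₂ (u≡v , _))  = ⊥-elim (u≢v u≡v)
    ... | yes (inj₂ (refl , refl)) | yes (inj₁ (v≡u , _))  = ⊥-elim (u≢v (≡-sym v≡u))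
    ... | yes xy  | no  ¬xw = j-free x w (isEdge-end xy) (old-edge x w exw ¬xw)
    ... | no  ¬xy | yes xw  = λ c≡j → j-free x y (isEdge-end xw) (old-edge x y exy ¬xy) (≡-sym c≡j)
    ... | no  ¬xy | no  ¬xw = c'-matching x y w (old-edge x y exy ¬xy) (old-edge x w exw ¬xw) y≢w

    class-growth : ∀ i x → ClassVertices E c i x →
                   ClassVertices E' c' i x ⊎ (i ≡ j × (x ≡ u ⊎ x ≡ v))
    class-growth i x (y , e , cxy≡i) with isEdge? u v x y
    ... | yes xy  = inj₂ (≡-sym cxy≡i , isEdge-end xy)
    ... | no  ¬xy = inj₁ (y , old-edge x y e ¬xy , cxy≡i)

    old-subgraph : ∀ i S F → IsSubgraphOfInduced G (ClassVertices E c i) S F →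
                   (∀ x → T (S x) → ¬ (i ≡ j × (x ≡ u ⊎ x ≡ v))) →
                   IsSubgraphOfInduced G (ClassVertices E' c' i) S F
    old-subgraph i S F (S⊆class , F-edges , F-sym) avoids = S⊆old , F-edges , F-sym
      where
      S⊆old : ∀ x → T (S x) → ClassVertices E' c' i x
      S⊆old x Sx with class-growth i x (S⊆class x Sx)
      ... | inj₁ old = old
      ... | inj₂ new = ⊥-elim (avoids x Sx new)

    module Endpoint (X Y : V) (XY : IsEdge u v X Y)
      (j∉X : ∀ w → T (E' X w) → c' X w ≢ j) (j∉Y : ∀ w → T (E' Y w) → c' Y w ≢ j) where

      was-in-class : ∀ w → T (adj G X w) → w ≢ Y →
                     ClassVertices E c j w → ClassVertices E' c' j w
      was-in-class w Xw w≢Y w∈class with class-growth j w w∈class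
      ... | inj₁ old        = old
      ... | inj₂ (_ , w∈uv) = ⊥-elim (endpoint XY w∈uv)
        where
        w≢X : w ≢ X
        w≢X refl = irrfl G w Xw
        endpoint : IsEdge u v X Y → (w ≡ u ⊎ w ≡ v) → ⊥
        endpoint (inj₁ (refl , _)) (inj₁ refl) = w≢X refl
        endpoint (inj₁ (_ , refl)) (inj₂ refl) = w≢Y refl
        endpoint (inj₂ (_ , refl)) (inj₁ refl) = w≢Y refl
        endpoint (inj₂ (refl , _)) (inj₂ refl) = w≢X refl

      -- ... and then its j-coloured edge wy has w ≠ Y and y ≠ X (as j is missing at X and Y),
      -- so it is listed in coloursNear X Y.
      counted-near : ∀ w → T (adj G X w) → ClassVertices E' c' j w →
                     T ((adj G X except Y) w) × 1 ≤ occ j (collect (E' w except X) (c' w))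
      counted-near w Xw (y , e'wy , c'wy≡j) =
        except-intro (adj G X) Xw w≢Y ,
        occ-collect (E' w except X) (c' w) j y (except-intro (E' w) e'wy y≢X) c'wy≡j
        where
        w≢Y : w ≢ Y
        w≢Y refl = j∉Y y e'wy c'wy≡j
        y≢X : y ≢ X
        y≢X refl = j∉X w (E'-sym w X e'wy) (trans (≡-sym (c'-sym w X e'wy)) c'wy≡j)

      neighbours-in-class : (f : V → Bool) →
        (∀ w → T (f w) → T (adj G X w) × ClassVertices E c j w × w ≢ Y) →
        count f ≤ occ j (coloursNear E' c' X Y)
      neighbours-in-class f f⊆N =
        count-≤-occ-concat j f (adj G X except Y) (λ w → collect (E' w except X) (c' w))
          (λ w fw → let (Xw , w∈class , w≢Y) = f⊆N w fw
                    in counted-near w Xw (was-in-class w Xw w≢Y w∈class))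

      subgraph-neighbours : ∀ S F → IsSubgraphOfInduced G (ClassVertices E c j) S F →
                            ∀ w → T (F X w) → T (adj G X w) × ClassVertices E c j w
      subgraph-neighbours S F (S⊆class , F-edges , _) w Fxw =
        proj₁ (F-edges X w Fxw) , S⊆class w (proj₂ (proj₂ (F-edges X w Fxw)))

      degree-without-partner : ∀ S F → IsSubgraphOfInduced G (ClassVertices E c j) S F →
                               ¬ T (S Y) → deg F X ≤ occ j (coloursNear E' c' X Y)
      degree-without-partner S F sub ¬SY = neighbours-in-class (F X) bound
        where
        bound : ∀ w → T (F X w) → T (adj G X w) × ClassVertices E c j w × w ≢ Y
        bound w Fxw = let (Xw , w∈class) = subgraph-neighbours S F sub w Fxw in
          Xw , w∈class , λ { refl → ¬SY (proj₂ (proj₂ (proj₁ (proj₂ sub) X w Fxw))) }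

      degree-with-partner : ∀ S F → IsSubgraphOfInduced G (ClassVertices E c j) S F →
                            deg F X ≤ suc (occ j (coloursNear E' c' X Y))
      degree-with-partner S F sub =
        ≤-trans (count-except (F X) Y) (s≤s (neighbours-in-class (F X except Y) bound))
        where
        bound : ∀ w → T ((F X except Y) w) → T (adj G X w) × ClassVertices E c j w × w ≢ Y
        bound w t = let (Fxw , w≢Y) = except-elim (F X) t
                        (Xw , w∈class) = subgraph-neighbours S F sub w Fxw in Xw , w∈class , w≢Y

    open Endpoint u v (inj₁ (refl , refl)) j∉u j∉v using () renaming
      (degree-without-partner to degree-u-without-v; degree-with-partner to degree-u-with-v)
    open Endpoint v u (inj₂ (refl , refl)) j∉v j∉u using () renaming
      (degree-without-partner to degree-v-without-u; degree-with-partner to degree-v-with-u)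

    near-u near-v : ℕ
    near-u = occ j (coloursNear E' c' u v)
    near-v = occ j (coloursNear E' c' v u)

    -- Every subgraph of G[V(M_i)] has a vertex of degree ≤ r: for i ≠ j, or if the subgraph
    -- avoids u and v, it is a subgraph of the old class; otherwise u or v has small degree.
    c-degenerate : ∀ i → DegenerateInduced G (ClassVertices E c i) r
    c-degenerate i S F sub nonempty with i Fin.≟ j
    ... | no i≢j =
      c'-degenerate i S F (old-subgraph i S F sub (λ _ _ (i≡j , _) → i≢j i≡j)) nonempty
    c-degenerate i S F sub nonempty | yes refl with S u in Su | S v in Sv
    ... | false | false = c'-degenerate j S F (old-subgraph j S F sub avoids) nonempty
      where
      avoids : ∀ x → T (S x) → ¬ (j ≡ j × (x ≡ u ⊎ x ≡ v))
      avoids x Sx (_ , inj₁ refl) = subst T Su Sx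
      avoids x Sx (_ , inj₂ refl) = subst T Sv Sx
    ... | true  | false = u , subst T (≡-sym Su) tt ,
      ≤-trans (degree-u-without-v S F sub (subst T Sv)) (≤-trans (m≤m+n near-u near-v) j-rare)
    ... | false | true  = v , subst T (≡-sym Sv) tt ,
      ≤-trans (degree-v-without-u S F sub (subst T Su)) (≤-trans (m≤n+m near-v near-u) j-rare)
    ... | true  | true with near-u ≤? near-v
    ...   | yes u≤v = u , subst T (≡-sym Su) tt ,
      ≤-trans (degree-u-with-v S F sub) (suc-smaller-≤ near-u near-v r r≥1 u≤v j-rare)
    ...   | no  u≰v = v , subst T (≡-sym Sv) tt ,
      ≤-trans (degree-v-with-u S F sub)
              (suc-smaller-≤ near-v near-u r r≥1 (<⇒≤ (≰⇒> u≰v))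
                             (subst (_≤ r) (+-comm near-u near-v) j-rare))

    c-good : IsGood E c
    c-good = (c-sym , c-matching) , c-degenerate

-- With maximum degree ≤ Δ and D = Δ - 1, when uv is not yet coloured
-- the lists coloursAt u, coloursAt v have ≤ D entries each and coloursNear u v,
-- coloursNear v u have ≤ D² entries each; so if (r+1)·2D + 2D² < (r+1)·K the pigeonhole
-- principle supplies a colour as required by the extension lemma, and all edges get coloured.
module Greedy (G : Graph) (r : ℕ) (r≥1 : 1 ≤ r) (Δ : ℕ) (maxDeg : MaxDegAtMost G Δ) (K : ℕ)
  (enough : suc r * ((Δ ∸ 1) + (Δ ∸ 1)) + ((Δ ∸ 1) * (Δ ∸ 1) + (Δ ∸ 1) * (Δ ∸ 1))
             < suc r * K) where

  open PartialColourings G r K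

  D : ℕ
  D = Δ ∸ 1

  missing-neighbour : (f : V → Bool) (x y : V) → (∀ w → T (f w) → T (adj G x w)) →
                      T (adj G x y) → ¬ T (f y) → count f ≤ D
  missing-neighbour f x y f⊆N xy ¬fy =
    ∸-monoˡ-≤ 1 (≤-trans (count-strict f (adj G x) y f⊆N xy ¬fy) (maxDeg x))

  module Uncoloured (E' : EdgeSet) (E'-in-G : InG E') (E'-sym : Symmetric E') (c' : Colouring) where

    length-coloursAt : ∀ X Y → T (adj G X Y) → ¬ T (E' X Y) → length (coloursAt E' c' X) ≤ D
    length-coloursAt X Y XY ¬E'XY =
      ≤-trans (≤-reflexive (length-collect (E' X) (c' X)))
              (missing-neighbour (E' X) X Y (E'-in-G X) XY ¬E'XY)

    length-coloursNear : ∀ X Y → T (adj G X Y) → length (coloursNear E' c' X Y) ≤ D * D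
    length-coloursNear X Y XY =
      ≤-trans (length-concat-collect (adj G X except Y) _ D few-edges) (*-monoˡ-≤ D few-neighbours)
      where
      few-neighbours : count (adj G X except Y) ≤ D
      few-neighbours = missing-neighbour (adj G X except Y) X Y
                         (λ w t → proj₁ (except-elim (adj G X) t)) XY (except-removes (adj G X) Y)
      few-edges : ∀ w → T ((adj G X except Y) w) → length (collect (E' w except X) (c' w)) ≤ D
      few-edges w t = ≤-trans (≤-reflexive (length-collect (E' w except X) (c' w)))
        (missing-neighbour (E' w except X) w X
          (λ y t' → E'-in-G w y (proj₁ (except-elim (E' w) t')))
          (sym G X w (proj₁ (except-elim (adj G X) t))) (except-removes (E' w) X))

    free-colour : ∀ u v → T (adj G u v) → ¬ T (E' u v) →
      ∃ λ j → (∀ w → T (E' u w) → c' u w ≢ j) × (∀ w → T (E' v w) → c' v w ≢ j) ×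
              (occ j (coloursNear E' c' u v) + occ j (coloursNear E' c' v u) ≤ r)
    free-colour u v uv ¬E'uv
      with pigeonhole r (coloursAt E' c' u ++ coloursAt E' c' v)
                        (coloursNear E' c' u v ++ coloursNear E' c' v u) few
      where
      vu : T (adj G v u)
      vu = sym G u v uv
      ¬E'vu : ¬ T (E' v u)
      ¬E'vu e = ¬E'uv (E'-sym v u e)
      few : suc r * length (coloursAt E' c' u ++ coloursAt E' c' v)
              + length (coloursNear E' c' u v ++ coloursNear E' c' v u) < suc r * K
      few = ≤-<-trans
        (+-mono-≤
          (*-monoʳ-≤ (suc r) (≤-trans (≤-reflexive (length-++ (coloursAt E' c' u)))
                     (+-mono-≤ (length-coloursAt u v uv ¬E'uv) (length-coloursAt v u vu ¬E'vu))))
          (≤-trans (≤-reflexive (length-++ (coloursNear E' c' u v)))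
                   (+-mono-≤ (length-coloursNear u v uv) (length-coloursNear v u vu))))
        enough
    ... | j , absent , rare = j ,
      collect-avoids (E' u) (c' u) j (m+n≡0⇒m≡0 _ absent-uv) ,
      collect-avoids (E' v) (c' v) j (m+n≡0⇒n≡0 (occ j (coloursAt E' c' u)) absent-uv) ,
      subst (_≤ r) (occ-++ j (coloursNear E' c' u v) _) rare
      where
      absent-uv : occ j (coloursAt E' c' u) + occ j (coloursAt E' c' v) ≡ 0
      absent-uv = trans (≡-sym (occ-++ j (coloursAt E' c' u) _)) absent

  extend-by-edge : ∀ E u v → T (E u v) → InG E → Symmetric E →
                   Σ Colouring (IsGood (deleteEdge u v E)) → Σ Colouring (IsGood E)
  extend-by-edge E u v e E-in-G E-sym (c' , c'-good) =
    let E'      = deleteEdge u v E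
        E'-in-G = deleteEdge-in-G u v E E-in-G
        E'-sym  = deleteEdge-sym u v E E-sym
        (j , j∉u , j∉v , j-rare) =
          Uncoloured.free-colour E' E'-in-G E'-sym c' u v (E-in-G u v e) (deleteEdge-deletes u v E)
        open Extension r≥1 E E' u v E'-in-G E'-sym (deleteEdge-restores u v E) (E-in-G u v e)
                       c' c'-good j j∉u j∉v j-rare
    in c , c-good

  some-colour : Fin K
  some-colour = nonempty K enough
    where
    nonempty : ∀ k {x} → x < suc r * k → Fin k
    nonempty zero {x} x<0 = ⊥-elim (n≮0 (subst (x <_) (*-zeroʳ (suc r)) x<0))
    nonempty (suc k) _   = zero

  colour-edges : ∀ s (E : EdgeSet) → size E ≤ s → InG E → Symmetric E → Σ Colouring (IsGood E)
  colour-edges s E small E-in-G E-sym with FinP.any? (λ x → FinP.any? (λ y → T? (E x y)))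
  ... | no noEdge = (λ _ _ → some-colour) , edgeless-good E (λ x y e → noEdge (x , y , e)) _
  colour-edges zero    E small E-in-G E-sym | yes (u , v , e) =
    ⊥-elim (n≮0 (<-≤-trans (deleteEdge-smaller u v E e) small))
  colour-edges (suc s) E small E-in-G E-sym | yes (u , v , e) =
    extend-by-edge E u v e E-in-G E-sym
      (colour-edges s (deleteEdge u v E) (≤-pred (<-≤-trans (deleteEdge-smaller u v E e) small))
                    (deleteEdge-in-G u v E E-in-G) (deleteEdge-sym u v E E-sym))

  colour-graph : Σ Colouring (IsGood (adj G))
  colour-graph = colour-edges (size (adj G)) (adj G) ≤-refl (λ _ _ e → e) (sym G)

-- With D = Δ - 1 and q = ⌊2D²/(r+1)⌋ take K = 2D + q + 1 colours: then
-- (r+1)·K ≤ 2D² + (r+1)(2D+1), which is the claimed bound, while (r+1)·K exceeds the count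
-- (r+1)·2D + 2D² of colours that can be blocked, because 2D² < (r+1)(q+1).
palette : ℕ → ℕ → ℕ
palette r D = suc (2 * D + 2 * D ^ 2 / suc r)

palette-fits : ∀ r D → suc r * palette r D ≤ 2 * D ^ 2 + suc r * (2 * D + 1)
palette-fits r D = begin
  suc r * suc (2 * D + q)           ≡⟨ expand r D q ⟩
  suc r * q + suc r * (2 * D + 1)   ≤⟨ +-monoˡ-≤ _ q[r+1]≤2D² ⟩
  2 * D ^ 2 + suc r * (2 * D + 1)   ∎
  where
  open ≤-Reasoning
  q : ℕ
  q = 2 * D ^ 2 / suc r
  q[r+1]≤2D² : suc r * q ≤ 2 * D ^ 2
  q[r+1]≤2D² = ≤-trans (≤-reflexive (*-comm (suc r) q)) (m/n*n≤m (2 * D ^ 2) (suc r))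
  expand : ∀ a d b → suc a * suc (2 * d + b) ≡ suc a * b + suc a * (2 * d + 1)
  expand = solve-∀

palette-suffices : ∀ r D → suc r * (D + D) + (D * D + D * D) < suc r * palette r D
palette-suffices r D = begin-strict
  suc r * (D + D) + (D * D + D * D)
    ≡⟨ cong (suc r * (D + D) +_) (twice-square D) ⟩
  suc r * (D + D) + 2 * D ^ 2
    ≡⟨ cong (suc r * (D + D) +_) (m≡m%n+[m/n]*n (2 * D ^ 2) (suc r)) ⟩
  suc r * (D + D) + (2 * D ^ 2 % suc r + q * suc r)
    <⟨ +-monoʳ-< (suc r * (D + D)) (+-monoˡ-< (q * suc r) (m%n<n (2 * D ^ 2) (suc r))) ⟩
  suc r * (D + D) + (suc r + q * suc r)
    ≡⟨ collect-terms r D q ⟩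
  suc r * suc (2 * D + q) ∎
  where
  open ≤-Reasoning
  q : ℕ
  q = 2 * D ^ 2 / suc r
  -- the right-hand side is 2 * d ^ 2 unfolded
  twice-square : ∀ d → d * d + d * d ≡ 2 * (d * (d * 1))
  twice-square = solve-∀
  collect-terms : ∀ a d b → suc a * (d + d) + (suc a + b * suc a) ≡ suc a * suc (2 * d + b)
  collect-terms = solve-∀

-- The theorem: after rewriting r + 1 as suc r, the greedy colouring with palette r D colours
-- witnesses the bound.
theorem1 : (r Δ : ℕ) → 1 ≤ r → 1 ≤ Δ → (G : Graph) → MaxDegAtMost G Δ →
    ChiDegAtMostFrac G r (2 * (Δ ∸ 1) ^ 2 + (r + 1) * (2 * (Δ ∸ 1) + 1)) (r + 1)
theorem1 r Δ r≥1 _ G maxDeg rewrite +-comm r 1 = palette r D , palette-fits r D , colour-graph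
  where
  D : ℕ
  D = Δ ∸ 1
  open Greedy G r r≥1 Δ maxDeg (palette r D) (palette-suffices r D) using (colour-graph)
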